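{- Let $\ell \geqslant 1$ be an integer, $T$ a finite $\ell$-minimal tree, and $v$ a vertex of $T$ with $\operatorname{ecc}_T(v) < \ell$. Then $\deg_T(v) \leqslant c(\mathbb{L}_\ell(T)) + 1$, where $c(\cdot)$ denotes the number of connected components.
   Context: An $\ell$-link of a graph is a walk $[v_0, e_1, \ldots, e_\ell, v_\ell]$ in which consecutive edges are different, identified with its reverse. The $\ell$-link graph $\mathbb{L}_\ell(G)$ has as vertices the $\ell$-links of $G$, and each $(\ell+1)$-link $[v_0, e_1, \ldots, e_{\ell+1}, v_{\ell+1}]$ is an edge joining $[v_0, \ldots, e_\ell, v_\ell]$ and $[v_1, \ldots, e_{\ell+1}, v_{\ell+1}]$. A graph $X$ with finite $\mathbb{L}_\ell(X)$ is $\ell$-minimal if $X$ is null or for every graph $Y$ isomorphic to a proper subgraph of $X$, $\mathbb{L}_\ell(Y)$ is isomorphic to a proper subgraph of $\mathbb{L}_\ell(X)$. $\operatorname{ecc}_T(v) = \max_u \operatorname{dist}_T(u,v)$. -}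

module Defs where

open import Level using (0ℓ)
open import Data.Nat using (ℕ; zero; suc; _+_; _<_)
open import Data.Bool using (Bool; true; false)
open import Data.Fin using (Fin; zero; suc; inject₁)
open import Data.Vec using (Vec; []; _∷_; lookup; toList; reverse; init; tail; last; head)
open import Data.List using (List; []; _∷_)
open import Data.Product using (Σ; _×_; _,_; ∃)
open import Data.Sum using (_⊎_)
open import Data.Empty using (⊥)
open import Data.Unit using (⊤)
open import Relation.Binary.PropositionalEquality using (_≡_; _≢_)
open import Relation.Nullary using (¬_)
open import Relation.Binary.Construct.Closure.ReflexiveTransitive using (Star)
open import Function using (_⇔_)

record SimpleGraph (n : ℕ) : Set where
  field
    adj    : Fin n → Fin n → Bool
    sym    : ∀ u v → adj u v ≡ adj v u
    irrefl : ∀ v → adj v v ≡ false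
open SimpleGraph public

E : ∀ {n} → SimpleGraph n → Fin n → Fin n → Set
E G u v = adj G u v ≡ true

countTrue : ∀ {n} → (Fin n → Bool) → ℕ
countTrue {zero}  f = 0
countTrue {suc n} f with f zero
... | true  = suc (countTrue (λ i → f (suc i)))
... | false = countTrue (λ i → f (suc i))

degree : ∀ {n} → SimpleGraph n → Fin n → ℕ
degree G v = countTrue (adj G v)

data Walk {n} (G : SimpleGraph n) : ℕ → Fin n → Fin n → Set where
  here : ∀ {u} → Walk G 0 u u
  step : ∀ {k u v w} → E G u v → Walk G k v w → Walk G (suc k) u w

Connected : ∀ {n} → SimpleGraph n → Set
Connected {n} G = ∀ (u w : Fin n) → ∃ λ k → Walk G k u w

Acyclic : ∀ {n} → SimpleGraph n → Set
Acyclic {n} G =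
  ∀ (k : ℕ) (c : Vec (Fin n) (3 + k)) →
    (∀ i j → lookup c i ≡ lookup c j → i ≡ j) →
    (∀ (i : Fin (2 + k)) → E G (lookup c (inject₁ i)) (lookup c (suc i))) →
    E G (last c) (head c) → ⊥

IsTree : ∀ {n} → SimpleGraph n → Set
IsTree G = Connected G × Acyclic G

EccLess : ∀ {n} → SimpleGraph n → Fin n → ℕ → Set
EccLess {n} G v ℓ = ∀ (u : Fin n) → ∃ λ k → k < ℓ × Walk G k v u

-- ℓ-links: walks v₀ e₁ … e_ℓ v_ℓ with consecutive edges different.
-- In a simple graph a walk is its vertex sequence, and e_i ≠ e_{i+1}
-- means v_{i-1} ≠ v_{i+1}.

NBWalk : ∀ {n} → SimpleGraph n → List (Fin n) → Set
NBWalk G []                  = ⊤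
NBWalk G (x ∷ [])            = ⊤
NBWalk G (x ∷ y ∷ [])        = E G x y
NBWalk G (x ∷ y ∷ z ∷ rest)  = E G x y × x ≢ z × NBWalk G (y ∷ z ∷ rest)

record Link {n} (G : SimpleGraph n) (ℓ : ℕ) : Set where
  constructor mkLink
  field
    verts  : Vec (Fin n) (suc ℓ)
    isLink : NBWalk G (toList verts)
open Link public

-- a link is identified with its reverse
SameLink : ∀ {n} {G : SimpleGraph n} {ℓ} → Link G ℓ → Link G ℓ → Set
SameLink a b = verts a ≡ verts b ⊎ verts a ≡ reverse (verts b)

-- Graphs whose vertex type carries an equivalence (vertices are classes),
-- with an adjacency relation (simple graphs).

record SGraph : Set₁ where
  field
    V   : Set
    _≈_ : V → V → Set
    Adj : V → V → Set
open SGraph public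

toSGraph : ∀ {n} → SimpleGraph n → SGraph
toSGraph {n} G = record { V = Fin n ; _≈_ = _≡_ ; Adj = E G }

LinkAdj : ∀ {n} (G : SimpleGraph n) (ℓ : ℕ) → Link G ℓ → Link G ℓ → Set
LinkAdj G ℓ a b = Σ (Link G (suc ℓ)) λ w →
  (init (verts w) ≡ verts a ⊎ init (verts w) ≡ reverse (verts a)) ×
  (tail (verts w) ≡ verts b ⊎ tail (verts w) ≡ reverse (verts b))

LinkGraph : ∀ {n} → ℕ → SimpleGraph n → SGraph
LinkGraph ℓ G = record { V = Link G ℓ ; _≈_ = SameLink ; Adj = LinkAdj G ℓ }

-- H is isomorphic to a subgraph of G: an injective (on classes) vertex map
-- sending edges to edges; the image subgraph is
-- (f(V(H)), f(E(H))).  It is proper iff it differs from G, i.e. not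
-- (every vertex of G is in the image and every edge of G is an image edge).

record Embedding (H G : SGraph) : Set where
  field
    f     : V H → V G
    resp  : ∀ {u w} → _≈_ H u w → _≈_ G (f u) (f w)
    inj   : ∀ {u w} → _≈_ G (f u) (f w) → _≈_ H u w
    hom   : ∀ {u w} → Adj H u w → Adj G (f u) (f w)
open Embedding public

IsoProperSubgraph : SGraph → SGraph → Set
IsoProperSubgraph H G = Σ (Embedding H G) λ e →
  ¬ ( (∀ x → Σ (V H) λ u → _≈_ G (f e u) x)
    × (∀ x y → Adj G x y →
         Σ (V H) λ u → Σ (V H) λ w →
           Adj H u w × _≈_ G (f e u) x × _≈_ G (f e w) y) )

-- X is ℓ-minimal: X null, or every Y isomorphic to a proper subgraph of X
-- has L_ℓ(Y) isomorphic to a proper subgraph of L_ℓ(X).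
-- (Graphs isomorphic to subgraphs of finite simple graphs are finite simple.)
IsMinimal : ∀ {n} → ℕ → SimpleGraph n → Set
IsMinimal {n} ℓ X =
  n ≡ 0 ⊎
  (∀ (m : ℕ) (Y : SimpleGraph m) →
     IsoProperSubgraph (toSGraph Y) (toSGraph X) →
     IsoProperSubgraph (LinkGraph ℓ Y) (LinkGraph ℓ X))

-- number of connected components: G has exactly k components iff there is
-- a surjection onto Fin k whose fibres are exactly the components

Conn : (G : SGraph) → V G → V G → Set
Conn G = Star (λ u w → Adj G u w ⊎ _≈_ G u w)

HasComponents : SGraph → ℕ → Set
HasComponents G k = Σ (V G → Fin k) λ c →
  (∀ (i : Fin k) → Σ (V G) λ u → c u ≡ i) ×
  (∀ u w → (c u ≡ c w) ⇔ Conn G u w)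

module Submission where

-- Root T at v.  Each vertex has a depth (its distance to v, below ℓ), a
-- parent, and a branch (its ancestor adjacent to v).  Acyclicity makes every
-- edge a parent–child edge, so a non-backtracking walk only goes up and then
-- down.  Hence an ℓ-link either avoids v and stays inside one branch, or goes
-- from a vertex u up to v and down to a vertex o with depth u + depth o = ℓ.
-- The set of branches met by a link is constant on each component of L_ℓ(T).
-- Fix a deepest vertex z, in branch x.  By ℓ-minimality every neighbour w of
-- v lies on some ℓ-link: otherwise L_ℓ(T) would embed into L_ℓ(T − w), which
-- embeds as a proper subgraph of the finite graph L_ℓ(T).  From that link we
-- obtain a link meeting branch w and no branch other than w and x (the link
-- itself, or the walk from its w-arm up to v and down towards z).  So the
-- neighbours w ≠ x of v lie in pairwise distinct components, and the degree
-- bound follows by counting.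

open import Defs hiding (sym; _≈_)
open import Level using (0ℓ)
open import Data.Nat using (ℕ; zero; suc; _+_; _∸_; _⊓_; _≤_; _<_; z≤n; s≤s; _≤?_)
open import Data.Nat.Properties hiding (_≟_)
open import Data.Bool using (Bool; true; false)
import Data.Bool as Bool
open import Data.Fin using (Fin; zero; suc; toℕ; inject₁; punchIn; punchOut; _≟_)
open import Data.Fin.Properties
  using (toℕ-injective; toℕ-inject₁; toℕ<n; punchIn-injective; punchInᵢ≢i; punchIn-punchOut;
         punchOut-injective)
  renaming (any? to any-vertex?)
import Data.Fin.Properties as Fin
open import Data.Vec as Vec using (Vec; []; _∷_; head; last; init; tail; reverse; toList)
open import Data.Vec.Properties
  using (length-toList; toList-reverse; toList-map; last-reverse; reverse-involutive; map-reverse; ≡-dec)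
open import Data.List as List
  using (List; []; _∷_; _++_; length; allFin; cartesianProduct; cartesianProductWith; deduplicate)
open import Data.List.Properties using (length-++)
open import Data.List.Relation.Unary.Any as Any using (Any; here; there; any?; satisfied)
import Data.List.Relation.Unary.Any.Properties as AnyP
import Data.List.Relation.Unary.All as All
open import Data.List.Relation.Unary.AllPairs using ([]; _∷_)
import Data.List.Relation.Unary.Unique.Setoid as UniqueSetoid
open import Data.List.Relation.Unary.Unique.DecSetoid.Properties using (deduplicate-!)
open import Data.List.Relation.Unary.Enumerates.Setoid.Properties using (deduplicate⁺)
open import Data.List.Membership.Propositional using (_∈_; find)
open import Data.List.Membership.Propositional.Properties
  using (∈-length; ∈-∃++; ∈-++⁻; ∈-++⁺ˡ; ∈-lookup; ∈-allFin;
         ∈-cartesianProductWith⁺; ∈-cartesianProduct⁺)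
import Data.List.Membership.DecPropositional as DecMembership
open import Data.List.Extrema.Nat using (argmax; f[xs]≤f[argmax])
open import Data.Unit using (tt)
open import Data.Product using (Σ; _×_; _,_; proj₁; proj₂)
open import Data.Sum using (_⊎_; inj₁; inj₂)
open import Data.Empty using (⊥; ⊥-elim)
open import Function using (_∘_)
open import Function.Bundles using (Equivalence)
open import Relation.Binary.Bundles using (DecSetoid)
open import Relation.Binary.Construct.Closure.ReflexiveTransitive using (ε; _◅_)
open import Relation.Nullary using (¬_; Dec; yes; no)
open import Relation.Nullary.Decidable using (_×-dec_; _⊎-dec_; ¬?)
open import Relation.Binary.PropositionalEquality
  using (_≡_; _≢_; refl; sym; trans; cong; cong₂; subst; subst₂; module ≡-Reasoning)

minimise : (P : ℕ → Set) → (∀ k → Dec (P k)) → ∀ k → P k →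
           Σ ℕ λ m → P m × (∀ j → P j → m ≤ j)
minimise P P? zero p = 0 , p , λ _ _ → z≤n
minimise P P? (suc k) p with P? 0
... | yes p₀ = 0 , p₀ , λ _ _ → z≤n
... | no ¬p₀ with minimise (P ∘ suc) (P? ∘ suc) k p
...   | m , pm , least = suc m , pm , λ
        { zero p₀ → ⊥-elim (¬p₀ p₀)
        ; (suc j) pj → s≤s (least j pj) }

maximise : (P : ℕ → Set) → (∀ k → Dec (P k)) → ∀ m → P 0 →
           Σ ℕ λ s → s ≤ m × P s × (∀ t → s < t → t ≤ m → ¬ P t)
maximise P P? zero p₀ = 0 , z≤n , p₀ , λ t 0<t t≤0 _ → <-irrefl refl (<-≤-trans 0<t t≤0)
maximise P P? (suc m) p₀ with P? (suc m)
... | yes p = suc m , ≤-refl , p , λ t m<t t≤m _ → <-irrefl refl (<-≤-trans m<t t≤m)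
... | no ¬p with maximise P P? m p₀
...   | s , s≤m , ps , above = s , ≤-trans s≤m (n≤1+n m) , ps , beyond
  where
  beyond : ∀ t → s < t → t ≤ suc m → ¬ P t
  beyond t s<t t≤1+m with t ≤? m
  ... | yes t≤m = above t s<t t≤m
  ... | no t≰m with ≤-antisym t≤1+m (≰⇒> t≰m)
  ...   | refl = ¬p

sample : ∀ {A : Set} → (ℕ → A) → ∀ m → Vec A m
sample c zero = []
sample c (suc m) = c 0 ∷ sample (c ∘ suc) m

lookup-sample : ∀ {A : Set} (c : ℕ → A) m (i : Fin m) → Vec.lookup (sample c m) i ≡ c (toℕ i)
lookup-sample c (suc m) zero = refl
lookup-sample c (suc m) (suc i) = lookup-sample (c ∘ suc) m i

last-sample : ∀ {A : Set} (c : ℕ → A) m → last (sample c (suc m)) ≡ c m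
last-sample c zero = refl
last-sample c (suc m) = last-sample (c ∘ suc) m

final : ∀ {A : Set} → A → List A → A
final x [] = x
final _ (y ∷ ys) = final y ys

final-++ : ∀ {A : Set} (x : A) xs y ys → final x (xs ++ y ∷ ys) ≡ final y ys
final-++ x [] y ys = refl
final-++ x (z ∷ xs) y ys = final-++ z xs y ys

final-∈ : ∀ {A : Set} (x : A) xs → final x xs ∈ x ∷ xs
final-∈ x [] = here refl
final-∈ x (y ∷ ys) = there (final-∈ y ys)

last-toList : ∀ {A : Set} {m} (x : A) (xs : Vec A m) → last (x ∷ xs) ≡ final x (toList xs)
last-toList x [] = refl
last-toList x (y ∷ xs) = last-toList y xs

init-map : ∀ {A B : Set} {k} (g : A → B) (Y : Vec A (suc k)) → init (Vec.map g Y) ≡ Vec.map g (init Y)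
init-map {k = zero} g (y ∷ []) = refl
init-map {k = suc k} g (y ∷ Y) = cong (g y ∷_) (init-map g Y)

∈-sample : ∀ {A : Set} (c : ℕ → A) m {z} → z ∈ toList (sample c m) → Σ ℕ λ i → i < m × z ≡ c i
∈-sample c (suc m) (here z≡c0) = 0 , s≤s z≤n , z≡c0
∈-sample c (suc m) (there z∈) with ∈-sample (c ∘ suc) m z∈
... | i , i<m , z≡ = suc i , s≤s i<m , z≡

-- X lists the entries of Y forwards or backwards; this is how ℓ-links are
-- identified with their reverses (SameLink a b is Oriented (verts a) (verts b)).
Oriented : ∀ {A : Set} {m} → Vec A m → Vec A m → Set
Oriented X Y = X ≡ Y ⊎ X ≡ reverse Y

oriented? : ∀ {n m} (X Y : Vec (Fin n) m) → Dec (Oriented X Y)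
oriented? X Y = ≡-dec _≟_ X Y ⊎-dec ≡-dec _≟_ X (reverse Y)

module _ {A : Set} {P : A → Set} where

  any-oriented : ∀ {m} {X Y : Vec A m} → Oriented X Y → Any P (toList X) → Any P (toList Y)
  any-oriented (inj₁ refl) p = p
  any-oriented {Y = Y} (inj₂ refl) p = AnyP.reverse⁻ (subst (Any P) (toList-reverse Y) p)

  any-oriented⁻ : ∀ {m} {X Y : Vec A m} → Oriented X Y → Any P (toList Y) → Any P (toList X)
  any-oriented⁻ (inj₁ refl) p = p
  any-oriented⁻ {Y = Y} (inj₂ refl) p = subst (Any P) (sym (toList-reverse Y)) (AnyP.reverse⁺ p)

  any-init : ∀ {m} (X : Vec A (suc m)) → Any P (toList (init X)) → Any P (toList X)
  any-init {zero} (x ∷ []) ()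
  any-init {suc m} (x ∷ X) (here p) = here p
  any-init {suc m} (x ∷ X) (there p) = there (any-init X p)

head-oriented : ∀ {A : Set} {m} {X Y : Vec A (suc m)} → Oriented X Y → head X ≡ head Y ⊎ head X ≡ last Y
head-oriented (inj₁ refl) = inj₁ refl
head-oriented {Y = Y} (inj₂ refl) = inj₂ (begin
    head (reverse Y)                    ≡⟨ sym (last-reverse (reverse Y)) ⟩
    last (reverse (reverse Y))          ≡⟨ cong last (reverse-involutive Y) ⟩
    last Y                              ∎)
  where open ≡-Reasoning

oriented-sym : ∀ {A : Set} {m} {X Y : Vec A m} → Oriented X Y → Oriented Y X
oriented-sym (inj₁ refl) = inj₁ refl
oriented-sym (inj₂ refl) = inj₂ (sym (reverse-involutive _))

oriented-trans : ∀ {A : Set} {m} {X Y Z : Vec A m} → Oriented X Y → Oriented Y Z → Oriented X Z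
oriented-trans (inj₁ refl) YZ = YZ
oriented-trans (inj₂ refl) (inj₁ refl) = inj₂ refl
oriented-trans (inj₂ refl) (inj₂ refl) = inj₁ (reverse-involutive _)

collect : ∀ {A : Set} {P : A → Set} → (∀ x → Dec (P x)) → List A → List (Σ A P)
collect P? [] = []
collect P? (x ∷ xs) with P? x
... | yes p = (x , p) ∷ collect P? xs
... | no _ = collect P? xs

collect-complete : ∀ {A : Set} {P : A → Set} (P? : ∀ x → Dec (P x)) {x xs} → x ∈ xs → P x →
                   Any (λ q → proj₁ q ≡ x) (collect P? xs)
collect-complete P? {xs = y ∷ ys} (here refl) p with P? y
... | yes _ = here refl
... | no ¬p = ⊥-elim (¬p p)
collect-complete P? {xs = y ∷ ys} (there x∈) p with P? y
... | yes _ = there (collect-complete P? x∈ p)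
... | no _ = collect-complete P? x∈ p

module _ (S : DecSetoid 0ℓ 0ℓ) where

  open DecSetoid S using (Carrier; _≈_; setoid)
    renaming (_≟_ to _≈?_; sym to ≈-sym; trans to ≈-trans; reflexive to ≈-reflexive)
  open UniqueSetoid setoid using (Unique)

  unique-lookup : ∀ {xs} → Unique xs → ∀ i j → List.lookup xs i ≈ List.lookup xs j → i ≡ j
  unique-lookup (_ ∷ _) zero zero _ = refl
  unique-lookup (fresh ∷ _) zero (suc j) x≈ = ⊥-elim (All.lookup fresh (∈-lookup j) x≈)
  unique-lookup (fresh ∷ _) (suc i) zero x≈ = ⊥-elim (All.lookup fresh (∈-lookup i) (≈-sym x≈))
  unique-lookup (_ ∷ unique) (suc i) (suc j) x≈ = cong suc (unique-lookup unique i j x≈)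

  injective⇒onto : (xs : List Carrier) → (∀ a → Any (a ≈_) xs) →
                   (H : Carrier → Carrier) → (∀ {a b} → a ≈ b → H a ≈ H b) →
                   (∀ {a b} → H a ≈ H b → a ≈ b) → ∀ y → Σ Carrier λ a → H a ≈ y
  injective⇒onto xs enum H H-cong H-inj y with any? (λ a → H a ≈? y) xs
  ... | yes hit = satisfied hit
  ... | no miss = ⊥-elim collision
    where
    reps = deduplicate _≈?_ xs
    -- y and the images of the representatives: one more than there are representatives
    point : Fin (suc (length reps)) → Carrier
    point zero = y
    point (suc i) = H (List.lookup reps i)
    slot : Fin (suc (length reps)) → Fin (length reps)
    slot i = Any.index (deduplicate⁺ S enum (point i))
    at : ∀ i → point i ≈ List.lookup reps (slot i)
    at i = AnyP.lookup-index (deduplicate⁺ S enum (point i))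
    missed : ∀ a → ¬ H a ≈ y
    missed a Ha≈y = miss (Any.map (λ a≈x → ≈-trans (H-cong (≈-sym a≈x)) Ha≈y) (enum a))
    distinct : ∀ i j → point i ≈ point j → i ≡ j
    distinct zero zero _ = refl
    distinct zero (suc j) y≈ = ⊥-elim (missed _ (≈-sym y≈))
    distinct (suc i) zero ≈y = ⊥-elim (missed _ ≈y)
    distinct (suc i) (suc j) H≈ = cong suc (unique-lookup (deduplicate-! S xs) i j (H-inj H≈))
    collision : ⊥
    collision with Fin.pigeonhole (n<1+n (length reps)) slot
    ... | i , j , i<j , same-slot = Fin.<⇒≢ i<j (distinct i j
          (≈-trans (at i) (≈-trans (≈-reflexive (cong (List.lookup reps) same-slot)) (≈-sym (at j)))))

countTrue-injection : ∀ {m k} (p : Fin m → Bool) (Φ : ∀ i → p i ≡ true → Fin k) →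
                      (∀ i j pi pj → Φ i pi ≡ Φ j pj → i ≡ j) → countTrue p ≤ k
countTrue-injection {zero} p Φ injective = z≤n
countTrue-injection {suc m} p Φ injective with p zero in p₀
... | false = countTrue-injection (p ∘ suc) (λ i → Φ (suc i))
                (λ i j pi pj eq → Fin.suc-injective (injective (suc i) (suc j) pi pj eq))
countTrue-injection {suc m} {zero} p Φ injective | true with Φ zero p₀
... | ()
countTrue-injection {suc m} {suc k} p Φ injective | true =
  s≤s (countTrue-injection (p ∘ suc) (λ i pi → punchOut (fresh i pi))
         (λ i j pi pj eq → Fin.suc-injective (injective (suc i) (suc j) pi pj
                             (punchOut-injective (fresh i pi) (fresh j pj) eq))))
  where
  -- later positions avoid the slot of position 0, so the slot can be removed
  fresh : ∀ i pi → Φ zero p₀ ≢ Φ (suc i) pi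
  fresh i pi eq with injective zero (suc i) p₀ pi eq
  ... | ()

countTrue-except : ∀ {m k} (p : Fin m → Bool) (x : Fin m) (Φ : ∀ i → p i ≡ true → i ≢ x → Fin k) →
                   (∀ i j pi pj i≢x j≢x → Φ i pi i≢x ≡ Φ j pj j≢x → i ≡ j) → countTrue p ≤ k + 1
countTrue-except {k = k} p x Φ injective =
  subst (countTrue p ≤_) (+-comm 1 k) (countTrue-injection p Φ′ injective′)
  where
  Φ′ : ∀ i → p i ≡ true → Fin (suc k)
  Φ′ i pi with i ≟ x
  ... | yes _ = zero
  ... | no i≢x = suc (Φ i pi i≢x)
  injective′ : ∀ i j pi pj → Φ′ i pi ≡ Φ′ j pj → i ≡ j
  injective′ i j pi pj eq with i ≟ x | j ≟ x
  ... | yes refl | yes refl = refl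
  ... | yes _ | no _ = ⊥-elim (Fin.0≢1+n eq)
  ... | no _ | yes _ = ⊥-elim (Fin.0≢1+n (sym eq))
  ... | no i≢x | no j≢x = injective i j pi pj i≢x j≢x (Fin.suc-injective eq)

_∘ᴱ_ : ∀ {A B C} → Embedding B C → Embedding A B → Embedding A C
F ∘ᴱ G = record { f = f F ∘ f G ; resp = λ e → resp F (resp G e) ; inj = λ e → inj G (inj F e)
                ; hom = λ e → hom F (hom G e) }

module _ {n} (G : SimpleGraph n) where

  E-sym : ∀ {x y} → E G x y → E G y x
  E-sym {x} {y} e = trans (SimpleGraph.sym G y x) e

  E-distinct : ∀ {x y} → E G x y → x ≢ y
  E-distinct {x} e refl with trans (sym e) (irrefl G x)
  ... | ()

  walk-snoc : ∀ {k u w z} → Walk G k u w → E G w z → Walk G (suc k) u z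
  walk-snoc here e = step e here
  walk-snoc (step e' W) e = step e' (walk-snoc W e)

  walk-reverse : ∀ {k u w} → Walk G k u w → Walk G k w u
  walk-reverse here = here
  walk-reverse (step e W) = walk-snoc (walk-reverse W) (E-sym e)

  E? : ∀ x y → Dec (E G x y)
  E? x y = adj G x y Bool.≟ true

  walk? : ∀ k u w → Dec (Walk G k u w)
  walk? zero u w with u ≟ w
  ... | yes refl = yes here
  ... | no u≢w = no λ { here → u≢w refl }
  walk? (suc k) u w with any-vertex? (λ y → E? u y ×-dec walk? k y w)
  ... | yes (y , e , W) = yes (step e W)
  ... | no none = no λ { (step {v = y} e W) → none (y , e , W) }

  noCycle : Acyclic G → ∀ L → 2 ≤ L → (c : ℕ → Fin n) →
            (∀ {i j} → i ≤ L → j ≤ L → c i ≡ c j → i ≡ j) →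
            (∀ {i} → i < L → E G (c i) (c (suc i))) →
            E G (c L) (c 0) → ⊥
  noCycle acyclic (suc (suc k)) (s≤s (s≤s z≤n)) c distinct edge closing =
    acyclic k cycle
      (λ i j eq → toℕ-injective (distinct (bound i) (bound j)
         (trans (sym (at i)) (trans eq (at j)))))
      (λ i → subst₂ (E G) (sym (trans (at (inject₁ i)) (cong c (toℕ-inject₁ i))))
                          (sym (at (suc i))) (edge (toℕ<n i)))
      (subst (λ z → E G z (c 0)) (sym (last-sample c (2 + k))) closing)
    where
    cycle = sample c (3 + k)
    at : ∀ i → Vec.lookup cycle i ≡ c (toℕ i)
    at = lookup-sample c (3 + k)
    bound : ∀ (i : Fin (3 + k)) → toℕ i ≤ 2 + k
    bound i = ≤-pred (toℕ<n i)

module _ {n} (G : SimpleGraph n) where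

  nb-tail : ∀ {x} xs → NBWalk G (x ∷ xs) → NBWalk G xs
  nb-tail [] _ = tt
  nb-tail (y ∷ []) _ = tt
  nb-tail (y ∷ z ∷ xs) (_ , _ , w) = w

  nb-first-edge : ∀ {x y} xs → NBWalk G (x ∷ y ∷ xs) → E G x y
  nb-first-edge [] e = e
  nb-first-edge (z ∷ xs) (e , _) = e

  nb-suffix : ∀ xs {ys} → NBWalk G (xs ++ ys) → NBWalk G ys
  nb-suffix [] w = w
  nb-suffix (x ∷ xs) {ys} w = nb-suffix xs (nb-tail (xs ++ ys) w)

  nb-prefix : ∀ xs z ys → NBWalk G (xs ++ z ∷ ys) → NBWalk G (xs ++ z ∷ [])
  nb-prefix [] z ys w = tt
  nb-prefix (x ∷ []) z [] w = w
  nb-prefix (x ∷ []) z (y ∷ ys) (e , _) = e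
  nb-prefix (x ∷ y ∷ []) z ys (e , x≢ , w) = e , x≢ , nb-prefix (y ∷ []) z ys w
  nb-prefix (x ∷ y ∷ u ∷ xs) z ys (e , x≢ , w) = e , x≢ , nb-prefix (y ∷ u ∷ xs) z ys w

  nb-sample : (c : ℕ → Fin n) → ∀ m → (∀ {i} → i < m → E G (c i) (c (suc i))) →
              (∀ {i} → suc (suc i) ≤ m → c i ≢ c (suc (suc i))) → NBWalk G (toList (sample c (suc m)))
  nb-sample c zero edge apart = tt
  nb-sample c (suc zero) edge apart = edge (s≤s z≤n)
  nb-sample c (suc (suc m)) edge apart =
    edge (s≤s z≤n) , apart (s≤s (s≤s z≤n)) ,
    nb-sample (c ∘ suc) (suc m) (λ i<m → edge (s≤s i<m)) (λ i+2≤m → apart (s≤s i+2≤m))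

∸-suc : ∀ {m n} → m < n → n ∸ m ≡ suc (n ∸ suc m)
∸-suc m<n = +-∸-assoc 1 m<n

module Rooted {n} (T : SimpleGraph n) (conn : Connected T) (v : Fin n) where

  -- Kept abstract: only the defining property of the minimum is used.
  abstract
    shortest : ∀ u → Σ ℕ λ m → Walk T m u v × (∀ j → Walk T j u v → m ≤ j)
    shortest u = minimise (λ k → Walk T k u v) (λ k → walk? T k u v)
                          (proj₁ (conn u v)) (proj₂ (conn u v))

    depth : Fin n → ℕ
    depth u = proj₁ (shortest u)

    geodesic : ∀ u → Walk T (depth u) u v
    geodesic u = proj₁ (proj₂ (shortest u))

    depth-minimal : ∀ u {j} → Walk T j u v → depth u ≤ j
    depth-minimal u W = proj₂ (proj₂ (shortest u)) _ W

  depth-root : depth v ≡ 0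
  depth-root = n≤0⇒n≡0 (depth-minimal v here)

  depth0⇒root : ∀ {u} → depth u ≡ 0 → u ≡ v
  depth0⇒root {u} eq = go eq (geodesic u)
    where go : ∀ {k} → k ≡ 0 → Walk T k u v → u ≡ v
          go refl here = refl

  depth-nonroot : ∀ {u} → u ≢ v → 0 < depth u
  depth-nonroot {u} u≢v with depth u in eq
  ... | zero = ⊥-elim (u≢v (depth0⇒root eq))
  ... | suc _ = s≤s z≤n

  positive⇒nonroot : ∀ {u} → 0 < depth u → u ≢ v
  positive⇒nonroot lt refl = <-irrefl (sym depth-root) lt

  depth-edge : ∀ {x y} → E T x y → depth y ≤ suc (depth x)
  depth-edge {x} {y} e = depth-minimal y (step (E-sym T e) (geodesic x))

  private
    next : ∀ {k a b} → Walk T k a b → Fin n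
    next {a = a} here = a
    next (step {v = y} e W) = y

    first-step : ∀ {u k} (W : Walk T k u v) → (∀ j → Walk T j u v → k ≤ j) → u ≢ v →
                 E T u (next W) × k ≡ suc (depth (next W))
    first-step here _ u≢v = ⊥-elim (u≢v refl)
    first-step (step {v = y} e W) W-shortest u≢v =
      e , cong suc (≤-antisym (≤-pred (W-shortest _ (step e (geodesic y)))) (depth-minimal y W))

  parent : Fin n → Fin n
  parent u = next (geodesic u)

  parent-edge : ∀ {u} → u ≢ v → E T u (parent u)
  parent-edge {u} u≢v = proj₁ (first-step (geodesic u) (λ _ → depth-minimal u) u≢v)

  depth-parent : ∀ {u} → u ≢ v → depth u ≡ suc (depth (parent u))
  depth-parent {u} u≢v = proj₂ (first-step (geodesic u) (λ _ → depth-minimal u) u≢v)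

  depth-neighbour : ∀ {y} → E T v y → depth y ≡ 1
  depth-neighbour {y} e = ≤-antisym (subst (λ d → depth y ≤ suc d) depth-root (depth-edge e))
                                    (depth-nonroot (E-distinct T e ∘ sym))

  parent-neighbour : ∀ {y} → E T v y → parent y ≡ v
  parent-neighbour {y} e = depth0⇒root (suc-injective
    (trans (sym (depth-parent (E-distinct T e ∘ sym))) (depth-neighbour e)))

  up : ℕ → Fin n → Fin n
  up zero a = a
  up (suc m) a = parent (up m a)

  up-+ : ∀ m k a → up m (up k a) ≡ up (m + k) a
  up-+ zero k a = refl
  up-+ (suc m) k a = cong parent (up-+ m k a)

  depth-up : ∀ m a → m ≤ depth a → depth (up m a) ≡ depth a ∸ m
  depth-up zero a _ = refl
  depth-up (suc m) a m<d = begin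
      depth (parent (up m a))  ≡⟨ cong (_∸ 1) (sym (depth-parent nonroot)) ⟩
      depth (up m a) ∸ 1       ≡⟨ cong (_∸ 1) ih ⟩
      depth a ∸ m ∸ 1          ≡⟨ ∸-+-assoc (depth a) m 1 ⟩
      depth a ∸ (m + 1)        ≡⟨ cong (depth a ∸_) (+-comm m 1) ⟩
      depth a ∸ suc m          ∎
    where
    open ≡-Reasoning
    ih = depth-up m a (<⇒≤ m<d)
    nonroot : up m a ≢ v
    nonroot = positive⇒nonroot (subst (0 <_) (sym ih) (m<n⇒0<n∸m m<d))

  ancestor : Fin n → ℕ → Fin n
  ancestor a t = up (depth a ∸ t) a

  depth-ancestor : ∀ a {t} → t ≤ depth a → depth (ancestor a t) ≡ t
  depth-ancestor a {t} t≤d = trans (depth-up (depth a ∸ t) a (m∸n≤m (depth a) t)) (m∸[m∸n]≡n t≤d)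

  ancestor-self : ∀ a → ancestor a (depth a) ≡ a
  ancestor-self a = cong (λ m → up m a) (n∸n≡0 (depth a))

  ancestor-root : ∀ a → ancestor a 0 ≡ v
  ancestor-root a = depth0⇒root (depth-ancestor a z≤n)

  ancestor-nonroot : ∀ a {t} → t ≤ depth a → 0 < t → ancestor a t ≢ v
  ancestor-nonroot a t≤d 0<t = positive⇒nonroot (subst (0 <_) (sym (depth-ancestor a t≤d)) 0<t)

  ancestor-step : ∀ a {t} → t < depth a → parent (ancestor a (suc t)) ≡ ancestor a t
  ancestor-step a t<d = sym (cong (λ m → up m a) (∸-suc t<d))

  ancestor-ancestor : ∀ a {t t'} → t' ≤ t → t ≤ depth a → ancestor (ancestor a t) t' ≡ ancestor a t'
  ancestor-ancestor a {t} {t'} t'≤t t≤d = begin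
      up (depth (ancestor a t) ∸ t') (ancestor a t) ≡⟨ cong (λ r → up (r ∸ t') (ancestor a t)) (depth-ancestor a t≤d) ⟩
      up (t ∸ t') (up (depth a ∸ t) a)              ≡⟨ up-+ (t ∸ t') (depth a ∸ t) a ⟩
      up ((t ∸ t') + (depth a ∸ t)) a               ≡⟨ cong (λ r → up r a) steps ⟩
      ancestor a t' ∎
    where
    open ≡-Reasoning
    steps : (t ∸ t') + (depth a ∸ t) ≡ depth a ∸ t'
    steps = begin
      (t ∸ t') + (depth a ∸ t)   ≡⟨ +-comm (t ∸ t') (depth a ∸ t) ⟩
      (depth a ∸ t) + (t ∸ t')   ≡⟨ sym (+-∸-assoc (depth a ∸ t) t'≤t) ⟩
      (depth a ∸ t) + t ∸ t'     ≡⟨ cong (_∸ t') (m∸n+n≡m t≤d) ⟩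
      depth a ∸ t' ∎

  parent-ancestor : ∀ {a} → a ≢ v → ancestor a (depth (parent a)) ≡ parent a
  parent-ancestor {a} a≢v = cong (λ m → up m a) (begin
      depth a ∸ d                 ≡⟨ cong (_∸ d) (depth-parent a≢v) ⟩
      suc d ∸ d                   ≡⟨ +-∸-assoc 1 (≤-refl {d}) ⟩
      suc (d ∸ d)                 ≡⟨ cong suc (n∸n≡0 d) ⟩
      1                           ∎)
    where
    open ≡-Reasoning
    d = depth (parent a)

  ancestor-parent : ∀ a {t} → a ≢ v → t ≤ depth (parent a) → ancestor (parent a) t ≡ ancestor a t
  ancestor-parent a {t} a≢v t≤dp = begin
      ancestor (parent a) t                        ≡⟨ cong (λ p → ancestor p t) (sym (parent-ancestor a≢v)) ⟩
      ancestor (ancestor a (depth (parent a))) t   ≡⟨ ancestor-ancestor a t≤dp dp≤d ⟩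
      ancestor a t                                 ∎
    where
    open ≡-Reasoning
    dp≤d = ≤-trans (n≤1+n _) (≤-reflexive (sym (depth-parent a≢v)))

  branch : Fin n → Fin n
  branch a = ancestor a 1

  branch-ancestor : ∀ a {t} → t ≤ depth a → ancestor a t ≢ v → branch (ancestor a t) ≡ branch a
  branch-ancestor a {t} t≤d nonroot = ancestor-ancestor a 1≤t t≤d
    where 1≤t = subst (1 ≤_) (depth-ancestor a t≤d) (depth-nonroot nonroot)

  branch-neighbour : ∀ {w} → E T v w → branch w ≡ w
  branch-neighbour {w} e = trans (cong (ancestor w) (sym (depth-neighbour e))) (ancestor-self w)

  -- The walk from x up to their common ancestor at depth s and down to y:
  -- path 0 = x, …, path rise = the common ancestor, …, path (rise + fall) = y.
  module Bend {x y : Fin n} {s : ℕ} (s≤x : s ≤ depth x) (s≤y : s ≤ depth y)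
              (meet : ancestor x s ≡ ancestor y s) where

    rise fall len : ℕ
    rise = depth x ∸ s
    fall = depth y ∸ s
    len = rise + fall

    path : ℕ → Fin n
    path i with i ≤? rise
    ... | yes _ = ancestor x (depth x ∸ i)
    ... | no _ = ancestor y (s + (i ∸ rise))

    path-up : ∀ {i} → i ≤ rise → path i ≡ ancestor x (depth x ∸ i)
    path-up {i} i≤r with i ≤? rise
    ... | yes _ = refl
    ... | no i≰r = ⊥-elim (i≰r i≤r)

    path-down : ∀ {i} → rise ≤ i → path i ≡ ancestor y (s + (i ∸ rise))
    path-down {i} r≤i with i ≤? rise
    ... | no _ = refl
    ... | yes i≤r = begin
        ancestor x (depth x ∸ i)        ≡⟨ cong (λ j → ancestor x (depth x ∸ j)) i≡r ⟩
        ancestor x (depth x ∸ rise)     ≡⟨ cong (ancestor x) (m∸[m∸n]≡n s≤x) ⟩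
        ancestor x s                    ≡⟨ meet ⟩
        ancestor y s                    ≡⟨ cong (ancestor y) (sym (+-identityʳ s)) ⟩
        ancestor y (s + 0)              ≡⟨ cong (λ j → ancestor y (s + j)) (sym (trans (cong (_∸ rise) i≡r) (n∸n≡0 rise))) ⟩
        ancestor y (s + (i ∸ rise))     ∎
      where
      open ≡-Reasoning
      i≡r = ≤-antisym i≤r r≤i

    private
      fall-bound : ∀ {i} → i ≤ len → s + (i ∸ rise) ≤ depth y
      fall-bound {i} i≤len = begin
          s + (i ∸ rise)     ≤⟨ +-monoʳ-≤ s (subst (i ∸ rise ≤_) (m+n∸m≡n rise fall) (∸-monoˡ-≤ rise i≤len)) ⟩
          s + fall           ≡⟨ m+[n∸m]≡n s≤y ⟩
          depth y            ∎
        where open ≤-Reasoning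

    depth-path-up : ∀ {i} → i ≤ rise → depth (path i) ≡ depth x ∸ i
    depth-path-up {i} i≤r = trans (cong depth (path-up i≤r)) (depth-ancestor x (m∸n≤m (depth x) i))

    depth-path-down : ∀ {i} → rise ≤ i → i ≤ len → depth (path i) ≡ s + (i ∸ rise)
    depth-path-down r≤i i≤len = trans (cong depth (path-down r≤i)) (depth-ancestor y (fall-bound i≤len))

    path-start : path 0 ≡ x
    path-start = trans (path-up z≤n) (ancestor-self x)

    path-end : path len ≡ y
    path-end = begin
        path len                            ≡⟨ path-down (m≤m+n rise fall) ⟩
        ancestor y (s + (len ∸ rise))       ≡⟨ cong (λ j → ancestor y (s + j)) (m+n∸m≡n rise fall) ⟩
        ancestor y (s + fall)               ≡⟨ cong (ancestor y) (m+[n∸m]≡n s≤y) ⟩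
        ancestor y (depth y)                ≡⟨ ancestor-self y ⟩
        y                                   ∎
      where open ≡-Reasoning

    private
      rise-step : ∀ {i} → suc i ≤ rise → depth x ∸ i ≡ suc (depth x ∸ suc i)
      rise-step i<r = ∸-suc (<-≤-trans i<r (m∸n≤m (depth x) s))

      fall-step : ∀ {i} → rise ≤ i → s + (suc i ∸ rise) ≡ suc (s + (i ∸ rise))
      fall-step r≤i = trans (cong (s +_) (+-∸-assoc 1 r≤i)) (+-suc s _)

    path-rises : ∀ {i} → suc i ≤ rise → parent (path i) ≡ path (suc i)
    path-rises {i} i<r = begin
        parent (path i)                                ≡⟨ cong parent (path-up (<⇒≤ i<r)) ⟩
        parent (ancestor x (depth x ∸ i))              ≡⟨ cong (λ t → parent (ancestor x t)) (rise-step i<r) ⟩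
        parent (ancestor x (suc (depth x ∸ suc i)))    ≡⟨ ancestor-step x t<d ⟩
        ancestor x (depth x ∸ suc i)                   ≡⟨ sym (path-up i<r) ⟩
        path (suc i)                                   ∎
      where
      open ≡-Reasoning
      t<d = subst (_≤ depth x) (rise-step i<r) (m∸n≤m (depth x) i)

    path-falls : ∀ {i} → rise ≤ i → i < len → parent (path (suc i)) ≡ path i
    path-falls {i} r≤i i<len = begin
        parent (path (suc i))                           ≡⟨ cong parent (path-down (≤-trans r≤i (n≤1+n i))) ⟩
        parent (ancestor y (s + (suc i ∸ rise)))        ≡⟨ cong (λ t → parent (ancestor y t)) (fall-step r≤i) ⟩
        parent (ancestor y (suc (s + (i ∸ rise))))      ≡⟨ ancestor-step y t<d ⟩
        ancestor y (s + (i ∸ rise))                     ≡⟨ sym (path-down r≤i) ⟩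
        path i                                          ∎
      where
      open ≡-Reasoning
      t<d = subst (_≤ depth y) (fall-step r≤i) (fall-bound i<len)

    path-edge : ∀ {i} → i < len → E T (path i) (path (suc i))
    path-edge {i} i<len = by-part (suc i ≤? rise)
      where
      by-part : Dec (suc i ≤ rise) → E T (path i) (path (suc i))
      by-part (yes i<r) = subst (E T (path i)) (path-rises i<r) (parent-edge (positive⇒nonroot 0<depth))
        where
        0<depth : 0 < depth (path i)
        0<depth = subst (0 <_) (sym (trans (depth-path-up (<⇒≤ i<r)) (rise-step i<r))) (s≤s z≤n)
      by-part (no i≮r) = E-sym T (subst (E T (path (suc i))) (path-falls r≤i i<len)
                                   (parent-edge (positive⇒nonroot 0<depth)))
        where
        r≤i = ≤-pred (≰⇒> i≮r)
        0<depth : 0 < depth (path (suc i))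
        0<depth = subst (0 <_) (sym (trans (depth-path-down (≤-trans r≤i (n≤1+n i)) i<len) (fall-step r≤i)))
                        (s≤s z≤n)

    path-branch : ∀ {i} → i ≤ len → path i ≢ v → branch (path i) ≡ branch x ⊎ branch (path i) ≡ branch y
    path-branch {i} i≤len nonroot = by-part (i ≤? rise)
      where
      by-part : Dec (i ≤ rise) → branch (path i) ≡ branch x ⊎ branch (path i) ≡ branch y
      by-part (yes i≤r) = inj₁ (trans (cong branch (path-up i≤r))
        (branch-ancestor x (m∸n≤m (depth x) i) (subst (_≢ v) (path-up i≤r) nonroot)))
      by-part (no i≰r) = inj₂ (trans (cong branch (path-down r≤i))
        (branch-ancestor y (fall-bound i≤len) (subst (_≢ v) (path-down r≤i) nonroot)))
        where r≤i = <⇒≤ (≰⇒> i≰r)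

    path-injective : (∀ t → s < t → t ≤ depth x → t ≤ depth y → ancestor x t ≢ ancestor y t) →
                     ∀ {i j} → i ≤ len → j ≤ len → path i ≡ path j → i ≡ j
    path-injective apart {i} {j} i≤len j≤len eq = by-parts (i ≤? rise) (j ≤? rise)
      where
      r≤x : rise ≤ depth x
      r≤x = m∸n≤m (depth x) s

      crossing : ∀ {i j} → i ≤ rise → rise < j → j ≤ len → path i ≢ path j
      crossing {i} {j} i≤r r<j j≤len eq = apart t s<t (m∸n≤m (depth x) i) t≤y
          (trans (sym (path-up i≤r)) (trans eq (trans (path-down (<⇒≤ r<j)) (cong (ancestor y) (sym t≡)))))
        where
        t = depth x ∸ i
        t≡ : t ≡ s + (j ∸ rise)
        t≡ = trans (sym (depth-path-up i≤r)) (trans (cong depth eq) (depth-path-down (<⇒≤ r<j) j≤len))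
        s<t : s < t
        s<t = subst (s <_) (sym t≡) (subst (_< s + (j ∸ rise)) (+-identityʳ s) (+-monoʳ-< s (m<n⇒0<n∸m r<j)))
        t≤y : t ≤ depth y
        t≤y = subst (_≤ depth y) (sym t≡) (fall-bound j≤len)

      by-parts : Dec (i ≤ rise) → Dec (j ≤ rise) → i ≡ j
      by-parts (yes i≤r) (yes j≤r) = ∸-cancelˡ-≡ (≤-trans i≤r r≤x) (≤-trans j≤r r≤x)
        (trans (sym (depth-path-up i≤r)) (trans (cong depth eq) (depth-path-up j≤r)))
      by-parts (yes i≤r) (no j≰r) = ⊥-elim (crossing i≤r (≰⇒> j≰r) j≤len eq)
      by-parts (no i≰r) (yes j≤r) = ⊥-elim (crossing j≤r (≰⇒> i≰r) i≤len (sym eq))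
      by-parts (no i≰r) (no j≰r) = begin
          i                   ≡⟨ sym (m+[n∸m]≡n r≤i) ⟩
          rise + (i ∸ rise)   ≡⟨ cong (rise +_) (+-cancelˡ-≡ s _ _ same-depth) ⟩
          rise + (j ∸ rise)   ≡⟨ m+[n∸m]≡n r≤j ⟩
          j                   ∎
        where
        open ≡-Reasoning
        r≤i = <⇒≤ (≰⇒> i≰r)
        r≤j = <⇒≤ (≰⇒> j≰r)
        same-depth = trans (sym (depth-path-down r≤i i≤len)) (trans (cong depth eq) (depth-path-down r≤j j≤len))

  -- In a tree, an edge whose ends are not parent and child would close a
  -- cycle through the lowest common ancestor of its ends.
  no-cross-edge : Acyclic T → ∀ {x y} → E T x y → parent x ≢ y → parent y ≢ x → ⊥
  no-cross-edge acyclic {x} {y} e px≢y py≢x =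
    noCycle T acyclic len (≮⇒≥ (λ len<2 → short (≤-pred len<2))) path
            (path-injective apart) path-edge closing
    where
    lowest-common = maximise (λ t → ancestor x t ≡ ancestor y t) (λ t → ancestor x t ≟ ancestor y t)
                      (depth x ⊓ depth y) (trans (ancestor-root x) (sym (ancestor-root y)))
    s = proj₁ lowest-common
    s≤x⊓y = proj₁ (proj₂ lowest-common)
    meet = proj₁ (proj₂ (proj₂ lowest-common))

    open Bend (≤-trans s≤x⊓y (m⊓n≤m _ _)) (≤-trans s≤x⊓y (m⊓n≤n _ _)) meet

    apart : ∀ t → s < t → t ≤ depth x → t ≤ depth y → ancestor x t ≢ ancestor y t
    apart t s<t t≤x t≤y = proj₂ (proj₂ (proj₂ lowest-common)) t s<t (⊓-glb t≤x t≤y)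

    closing : E T (path len) (path 0)
    closing = subst₂ (E T) (sym path-end) (sym path-start) (E-sym T e)

    -- a path of length at most one would make x, y equal or parent and child
    short : len ≤ 1 → ⊥
    short len≤1 with len in len≡
    ... | zero = E-distinct T e (trans (sym path-start) (trans (cong path (sym len≡)) path-end))
    ... | suc zero = by-rise (1 ≤? rise)
      where
      path1≡y : path 1 ≡ y
      path1≡y = trans (cong path (sym len≡)) path-end
      by-rise : Dec (1 ≤ rise) → ⊥
      by-rise (yes 0<r) = px≢y (trans (cong parent (sym path-start)) (trans (path-rises 0<r) path1≡y))
      by-rise (no 0≮r) = py≢x (trans (cong parent (sym path1≡y))
        (trans (path-falls (≤-pred (≰⇒> 0≮r)) (subst (0 <_) (sym len≡) (s≤s z≤n))) path-start))
    short (s≤s ()) | suc (suc _)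

  edge-parent : Acyclic T → ∀ {x y} → E T x y → (x ≢ v × parent x ≡ y) ⊎ (y ≢ v × parent y ≡ x)
  edge-parent acyclic {x} {y} e with x ≟ v | y ≟ v
  ... | yes refl | _ = inj₂ (E-distinct T e ∘ sym , parent-neighbour e)
  ... | no x≢v | yes refl = inj₁ (x≢v , parent-neighbour (E-sym T e))
  ... | no x≢v | no y≢v with parent x ≟ y | parent y ≟ x
  ...   | yes px≡y | _ = inj₁ (x≢v , px≡y)
  ...   | no _ | yes py≡x = inj₂ (y≢v , py≡x)
  ...   | no px≢y | no py≢x = ⊥-elim (no-cross-edge acyclic e px≢y py≢x)

  branch-parent : ∀ {a} → a ≢ v → parent a ≢ v → branch (parent a) ≡ branch a
  branch-parent {a} a≢v pa≢v = ancestor-parent a a≢v (depth-nonroot pa≢v)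

  branch-edge : Acyclic T → ∀ {x y} → E T x y → x ≢ v → y ≢ v → branch x ≡ branch y
  branch-edge acyclic {x} {y} e x≢v y≢v with edge-parent acyclic e
  ... | inj₁ (_ , refl) = sym (branch-parent x≢v y≢v)
  ... | inj₂ (_ , refl) = branch-parent y≢v x≢v

  depth<ℓ : ∀ {ℓ} → EccLess T v ℓ → ∀ u → depth u < ℓ
  depth<ℓ ecc u = ≤-<-trans (depth-minimal u (walk-reverse T (proj₂ (proj₂ (ecc u))))) (proj₁ (proj₂ (ecc u)))

module RootedLinks {n} (T : SimpleGraph n) (conn : Connected T) (acyclic : Acyclic T)
                   (v : Fin n) (ℓ : ℕ) (ecc : EccLess T v ℓ) where

  open Rooted T conn v

  -- Once a non-backtracking walk steps from a vertex to a child it keeps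
  -- stepping to children: it stays in one branch and gains a level per step.
  descent : ∀ x y rest → NBWalk T (x ∷ y ∷ rest) → parent y ≡ x → y ≢ v →
            depth (final y rest) ≡ depth y + length rest ×
            (∀ z → z ∈ y ∷ rest → z ≢ v × branch z ≡ branch y)
  descent x y [] w py≡x y≢v = sym (+-identityʳ _) , λ { z (here refl) → y≢v , refl }
  descent x y (z ∷ rest) (_ , x≢z , w) py≡x y≢v with edge-parent acyclic (nb-first-edge T rest w)
  ... | inj₁ (_ , py≡z) = ⊥-elim (x≢z (trans (sym py≡x) py≡z))
  ... | inj₂ (z≢v , pz≡y) = depth-final , in-branch
    where
    ih = descent y z rest w pz≡y z≢v
    open ≡-Reasoning
    depth-final : depth (final z rest) ≡ depth y + length (z ∷ rest)
    depth-final = begin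
      depth (final z rest)              ≡⟨ proj₁ ih ⟩
      depth z + length rest             ≡⟨ cong (_+ length rest) (trans (depth-parent z≢v) (cong (suc ∘ depth) pz≡y)) ⟩
      suc (depth y) + length rest       ≡⟨ sym (+-suc (depth y) (length rest)) ⟩
      depth y + length (z ∷ rest)       ∎
    z-branch : branch z ≡ branch y
    z-branch = trans (sym (branch-parent z≢v (subst (_≢ v) (sym pz≡y) y≢v))) (cong branch pz≡y)
    in-branch : ∀ u → u ∈ y ∷ z ∷ rest → u ≢ v × branch u ≡ branch y
    in-branch u (here refl) = y≢v , refl
    in-branch u (there u∈) = proj₁ (proj₂ ih u u∈) , trans (proj₂ (proj₂ ih u u∈)) z-branch

  -- A non-backtracking walk ending at the root steps to parents only: its
  -- first vertex has depth equal to its length, and it stays in one branch.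
  ascent : ∀ x rest → NBWalk T (x ∷ rest) → final x rest ≡ v →
           depth x ≡ length rest × (∀ z → z ∈ x ∷ rest → z ≢ v → branch z ≡ branch x)
  ascent x [] w refl = depth-root , λ { z (here refl) _ → refl }
  ascent x (y ∷ rest) w end with edge-parent acyclic (nb-first-edge T rest w)
  ... | inj₂ (y≢v , py≡x) = ⊥-elim (1+n≢0 (begin
        suc (depth x) + length rest  ≡⟨ cong (λ d → suc (depth d) + length rest) (sym py≡x) ⟩
        suc (depth (parent y)) + length rest  ≡⟨ cong (_+ length rest) (sym (depth-parent y≢v)) ⟩
        depth y + length rest  ≡⟨ sym (proj₁ (descent x y rest w py≡x y≢v)) ⟩
        depth (final y rest)   ≡⟨ cong depth end ⟩
        depth v                ≡⟨ depth-root ⟩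
        0 ∎))
    where open ≡-Reasoning
  ... | inj₁ (x≢v , px≡y) = trans (depth-parent x≢v) (cong suc (trans (cong depth px≡y) (proj₁ ih))) , in-branch
    where
    ih = ascent y rest (nb-tail T (y ∷ rest) w) end
    in-branch : ∀ z → z ∈ x ∷ y ∷ rest → z ≢ v → branch z ≡ branch x
    in-branch z (here refl) _ = refl
    in-branch z (there z∈) z≢v with y ≟ v
    ... | no y≢v = trans (proj₂ ih z z∈ z≢v)
                     (trans (cong branch (sym px≡y)) (branch-parent x≢v (subst (_≢ v) (sym px≡y) y≢v)))
    ... | yes refl with z∈
    ...   | here refl = ⊥-elim (z≢v refl)
    ...   | there z∈rest = ⊥-elim (<⇒≢ (∈-length z∈rest) (sym (trans (sym (proj₁ ih)) depth-root)))

  -- The ends of an ℓ-link are not the root, since all depths are below ℓ.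
  start-nonroot : ∀ x rest → NBWalk T (x ∷ rest) → length rest ≡ ℓ → x ≢ v
  start-nonroot x [] _ len refl = n≮0 (subst (depth v <_) (sym len) (depth<ℓ ecc v))
  start-nonroot x (y ∷ rest) w len refl = <-irrefl depth≡ℓ (depth<ℓ ecc (final y rest))
    where
    e = nb-first-edge T rest w
    depth≡ℓ : depth (final y rest) ≡ ℓ
    depth≡ℓ = trans (proj₁ (descent x y rest w (parent-neighbour e) (E-distinct T e ∘ sym)))
                    (trans (cong (_+ length rest) (depth-neighbour e)) len)

  end-nonroot : ∀ x rest → NBWalk T (x ∷ rest) → length rest ≡ ℓ → final x rest ≢ v
  end-nonroot x rest w len end = <-irrefl (trans (proj₁ (ascent x rest w end)) len) (depth<ℓ ecc x)

  -- An ℓ-link through the root is an ascent from its first vertex a to v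
  -- followed by a descent to its last vertex b; hence depth a + depth b = ℓ
  -- and its non-root vertices lie in the branch of a or of b.
  through-root : ∀ x rest → NBWalk T (x ∷ rest) → length rest ≡ ℓ → v ∈ x ∷ rest →
                 depth x + depth (final x rest) ≡ ℓ ×
                 (∀ z → z ∈ x ∷ rest → z ≢ v → branch z ≡ branch x ⊎ branch z ≡ branch (final x rest))
  through-root x rest w len v∈ with ∈-∃++ v∈
  ... | [] , _ , refl = ⊥-elim (start-nonroot x rest w len refl)
  ... | _ ∷ A , [] , refl = ⊥-elim (end-nonroot x rest w len (final-++ x A v []))
  ... | _ ∷ A , b ∷ B , refl = depths , branches
    where
    rising = ascent x (A ++ v ∷ []) (nb-prefix T (x ∷ A) v (b ∷ B) w) (final-++ x A v [])
    down-walk = nb-suffix T (x ∷ A) w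
    e = nb-first-edge T B down-walk
    falling = descent v b B down-walk (parent-neighbour e) (E-distinct T e ∘ sym)
    final≡ : final x (A ++ v ∷ b ∷ B) ≡ final b B
    final≡ = final-++ x A v (b ∷ B)
    open ≡-Reasoning
    depths : depth x + depth (final x (A ++ v ∷ b ∷ B)) ≡ ℓ
    depths = begin
      depth x + depth (final x (A ++ v ∷ b ∷ B))  ≡⟨ cong₂ _+_ (proj₁ rising) (cong depth final≡) ⟩
      length (A ++ v ∷ []) + depth (final b B)    ≡⟨ cong₂ _+_ (length-++ A) (proj₁ falling) ⟩
      (length A + 1) + (depth b + length B)       ≡⟨ cong (λ d → (length A + 1) + (d + length B)) (depth-neighbour e) ⟩
      (length A + 1) + (1 + length B)             ≡⟨ +-assoc (length A) 1 (1 + length B) ⟩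
      length A + length (v ∷ b ∷ B)              ≡⟨ sym (length-++ A) ⟩
      length (A ++ v ∷ b ∷ B)                     ≡⟨ len ⟩
      ℓ ∎
    branches : ∀ z → z ∈ x ∷ A ++ v ∷ b ∷ B → z ≢ v →
               branch z ≡ branch x ⊎ branch z ≡ branch (final x (A ++ v ∷ b ∷ B))
    branches z z∈ z≢v with ∈-++⁻ (x ∷ A) z∈
    ... | inj₁ z∈A = inj₁ (proj₂ rising z (∈-++⁺ˡ z∈A) z≢v)
    ... | inj₂ (here refl) = ⊥-elim (z≢v refl)
    ... | inj₂ (there z∈B) = inj₂ (trans (proj₂ (proj₂ falling z z∈B))
            (sym (trans (cong branch final≡) (proj₂ (proj₂ falling (final b B) (final-∈ b B))))))

  avoiding-root : ∀ x rest → NBWalk T (x ∷ rest) → ¬ v ∈ x ∷ rest →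
                  ∀ z → z ∈ x ∷ rest → branch z ≡ branch x
  avoiding-root x rest w v∉ z (here refl) = refl
  avoiding-root x (y ∷ rest) w v∉ z (there z∈) =
    trans (avoiding-root y rest (nb-tail T (y ∷ rest) w) (v∉ ∘ there) z z∈)
          (sym (branch-edge acyclic (nb-first-edge T rest w) (v∉ ∘ here ∘ sym) (v∉ ∘ there ∘ here ∘ sym)))

  link-ends-nonroot : (P : Link T ℓ) → head (verts P) ≢ v × last (verts P) ≢ v
  link-ends-nonroot (mkLink (x ∷ xs) w) =
    start-nonroot x (toList xs) w (length-toList xs) ,
    subst (_≢ v) (sym (last-toList x xs)) (end-nonroot x (toList xs) w (length-toList xs))

  Meets : Fin n → Link T ℓ → Set
  Meets c P = Any (λ z → z ≢ v × branch z ≡ c) (toList (verts P))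

  -- Arms w: non-root vertices u, o with u in the branch of w and
  -- depth u + depth o = ℓ, as the two ends of an ℓ-link through the root.
  Arms : Fin n → Set
  Arms w = Σ (Fin n) λ u → Σ (Fin n) λ o → u ≢ v × o ≢ v × branch u ≡ branch w × depth u + depth o ≡ ℓ

  link-shape : (P : Link T ℓ) → ∀ {w} → w ∈ toList (verts P) → w ≢ v →
               (∀ c → Meets c P → c ≡ branch w) ⊎ Arms w
  link-shape (mkLink (x ∷ xs) walk) {w} w∈ w≢v with DecMembership._∈?_ _≟_ v (toList (x ∷ xs))
  ... | no v∉ = inj₁ λ c meets →
        let (z , z∈ , _ , z-branch) = find meets
            same = avoiding-root x (toList xs) walk v∉
        in trans (sym z-branch) (trans (same z z∈) (sym (same w w∈)))
  ... | yes v∈ with through-root x (toList xs) walk (length-toList xs) v∈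
  ...   | depths , branches with branches w w∈ w≢v
  ...     | inj₁ w-branch = inj₂ (x , final x (toList xs) , start-nonroot x _ walk (length-toList xs) ,
                                  end-nonroot x _ walk (length-toList xs) , sym w-branch , depths)
  ...     | inj₂ w-branch = inj₂ (final x (toList xs) , x , end-nonroot x _ walk (length-toList xs) ,
                                  start-nonroot x _ walk (length-toList xs) , sym w-branch ,
                                  trans (+-comm _ (depth x)) depths)

  -- For a non-root u with depth u + d = ℓ (d ≥ 1) and a vertex z of depth
  -- at least d in another branch, going from u up to v and down towards z
  -- to depth d is an ℓ-link meeting exactly the branches of u and z.
  bend-link : ∀ {u z} d → u ≢ v → 1 ≤ d → depth u + d ≡ ℓ → d ≤ depth z → branch u ≢ branch z →
              Σ (Link T ℓ) λ Q → Meets (branch u) Q × (∀ c → Meets c Q → c ≡ branch u ⊎ c ≡ branch z)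
  bend-link {u} {z} d u≢v 1≤d len≡ d≤z u≁z = Q , meets-u , meets-only
    where
    y = ancestor z d
    depth-y : depth y ≡ d
    depth-y = depth-ancestor z d≤z
    y-branch : branch y ≡ branch z
    y-branch = branch-ancestor z d≤z (ancestor-nonroot z d≤z 1≤d)

    open Bend {u} {y} {0} z≤n z≤n (trans (ancestor-root u) (sym (ancestor-root y)))

    len≡ℓ : len ≡ ℓ
    len≡ℓ = trans (cong (depth u +_) depth-y) len≡

    apart : ∀ t → 0 < t → t ≤ depth u → t ≤ depth y → ancestor u t ≢ ancestor y t
    apart t 0<t t≤u t≤y same = u≁z (begin
        branch u                ≡⟨ sym (branch-ancestor u t≤u (ancestor-nonroot u t≤u 0<t)) ⟩
        branch (ancestor u t)   ≡⟨ cong branch same ⟩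
        branch (ancestor y t)   ≡⟨ branch-ancestor y t≤y (ancestor-nonroot y t≤y 0<t) ⟩
        branch y                ≡⟨ y-branch ⟩
        branch z                ∎)
      where open ≡-Reasoning

    walk : NBWalk T (toList (sample path (suc ℓ)))
    walk = nb-sample T path ℓ (λ i<ℓ → path-edge (subst (_ <_) (sym len≡ℓ) i<ℓ))
      (λ {i} i+2≤ℓ same → let i+2≤len = subst (suc (suc i) ≤_) (sym len≡ℓ) i+2≤ℓ in
         m≢1+n+m i (path-injective apart (≤-trans (≤-trans (n≤1+n i) (n≤1+n _)) i+2≤len) i+2≤len same))

    Q : Link T ℓ
    Q = mkLink (sample path (suc ℓ)) walk

    meets-u : Meets (branch u) Q
    meets-u = here (subst (_≢ v) (sym path-start) u≢v , cong branch path-start)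

    meets-only : ∀ c → Meets c Q → c ≡ branch u ⊎ c ≡ branch z
    meets-only c meets with find meets
    ... | z' , z'∈ , z'≢v , refl with ∈-sample path (suc ℓ) z'∈
    ...   | i , i≤ℓ , refl with path-branch (subst (i ≤_) (sym len≡ℓ) (≤-pred i≤ℓ)) z'≢v
    ...     | inj₁ in-u = inj₁ in-u
    ...     | inj₂ in-y = inj₂ (trans in-y y-branch)

  -- Adjacent links meet the same branches: passing from a to b drops only
  -- the first vertex x₀ of the (ℓ+1)-link, whose neighbour x₁ is an end of b,
  -- hence not the root and in the branch of x₀.
  meets-adjacent : ∀ {c a b} → LinkAdj T ℓ a b → Meets c a → Meets c b
  meets-adjacent {c} {a} {b} (mkLink (x₀ ∷ x₁ ∷ xs) walk , init≈a , tail≈b) meets =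
    any-oriented tail≈b (shift (any-oriented⁻ init≈a meets))
    where
    x₁≢v : x₁ ≢ v
    x₁≢v with head-oriented tail≈b
    ... | inj₁ x₁≡head = subst (_≢ v) (sym x₁≡head) (proj₁ (link-ends-nonroot b))
    ... | inj₂ x₁≡last = subst (_≢ v) (sym x₁≡last) (proj₂ (link-ends-nonroot b))
    shift : Any (λ z → z ≢ v × branch z ≡ c) (toList (init (x₀ ∷ x₁ ∷ xs))) →
            Any (λ z → z ≢ v × branch z ≡ c) (toList (x₁ ∷ xs))
    shift (here (x₀≢v , x₀-branch)) =
      here (x₁≢v , trans (sym (branch-edge acyclic (nb-first-edge T (toList xs) walk) x₀≢v x₁≢v)) x₀-branch)
    shift (there p) = any-init (x₁ ∷ xs) p

  meets-connected : ∀ {c a b} → Conn (LinkGraph ℓ T) a b → Meets c a → Meets c b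
  meets-connected ε meets = meets
  meets-connected {a = a} (_◅_ {j = b} (inj₁ adjacent) rest) meets =
    meets-connected rest (meets-adjacent {a = a} {b = b} adjacent meets)
  meets-connected (inj₂ same ◅ rest) meets = meets-connected rest (any-oriented same meets)

module FiniteLinks {n} (G : SimpleGraph n) where

  vectors : ∀ m → List (Vec (Fin n) m)
  vectors zero = [] ∷ []
  vectors (suc m) = cartesianProductWith _∷_ (allFin n) (vectors m)

  vectors-complete : ∀ {m} (X : Vec (Fin n) m) → X ∈ vectors m
  vectors-complete [] = here refl
  vectors-complete (x ∷ X) = ∈-cartesianProductWith⁺ _∷_ (∈-allFin x) (vectors-complete X)

  nb? : ∀ xs → Dec (NBWalk G xs)
  nb? [] = yes tt
  nb? (x ∷ []) = yes tt
  nb? (x ∷ y ∷ []) = E? G x y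
  nb? (x ∷ y ∷ z ∷ xs) = E? G x y ×-dec (¬? (x ≟ z) ×-dec nb? (y ∷ z ∷ xs))

  links : ∀ m → List (Link G m)
  links m = List.map (λ q → mkLink (proj₁ q) (proj₂ q)) (collect (nb? ∘ toList) (vectors (suc m)))

  links-complete : ∀ {m} (P : Link G m) → Any (λ Q → verts Q ≡ verts P) (links m)
  links-complete P = AnyP.map⁺ (collect-complete (nb? ∘ toList) (vectors-complete (verts P)) (isLink P))

  module _ (m : ℕ) where

    same? : (a b : Link G m) → Dec (SameLink a b)
    same? a b = oriented? (verts a) (verts b)

    LinkSetoid : DecSetoid 0ℓ 0ℓ
    LinkSetoid = record
      { Carrier = Link G m ; _≈_ = SameLink
      ; isDecEquivalence = record
        { isEquivalence = record { refl = inj₁ refl ; sym = oriented-sym ; trans = oriented-trans }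
        ; _≟_ = same? } }

    links-enumerate : ∀ a → Any (SameLink a) (links m)
    links-enumerate a = Any.map (λ eq → inj₁ (sym eq)) (links-complete a)

    adjacent-respects : ∀ {a a' b b'} → SameLink a a' → SameLink b b' → LinkAdj G m a b → LinkAdj G m a' b'
    adjacent-respects a≈a' b≈b' (w , init≈a , tail≈b) =
      w , oriented-trans init≈a a≈a' , oriented-trans tail≈b b≈b'

    Joins : Vec (Fin n) (suc (suc m)) → Link G m → Link G m → Set
    Joins W a b = Oriented (init W) (verts a) × Oriented (tail W) (verts b)

    adjacent? : ∀ a b → Dec (LinkAdj G m a b)
    adjacent? a b with any? (λ w → joins? (verts w)) (links (suc m))
      where
      joins? : ∀ W → Dec (Joins W a b)
      joins? W = oriented? (init W) (verts a) ×-dec oriented? (tail W) (verts b)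
    ... | yes found = yes (satisfied found)
    ... | no none = no λ (w , joins) →
          none (Any.map (λ eq → subst (λ W → Joins W a b) (sym eq) joins) (links-complete w))

    Edge : Set
    Edge = Σ (Link G m × Link G m) λ p → LinkAdj G m (proj₁ p) (proj₂ p)

    _≈ᴱ_ : Edge → Edge → Set
    ((a , b) , _) ≈ᴱ ((a' , b') , _) = SameLink a a' × SameLink b b'

    EdgeSetoid : DecSetoid 0ℓ 0ℓ
    EdgeSetoid = record
      { Carrier = Edge ; _≈_ = _≈ᴱ_
      ; isDecEquivalence = record
        { isEquivalence = record
          { refl = inj₁ refl , inj₁ refl
          ; sym = λ (a≈ , b≈) → oriented-sym a≈ , oriented-sym b≈
          ; trans = λ (a≈ , b≈) (a≈' , b≈') → oriented-trans a≈ a≈' , oriented-trans b≈ b≈' }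
        ; _≟_ = λ ((a , b) , _) ((a' , b') , _) → same? a a' ×-dec same? b b' } }

    adjacent-pair? : ∀ p → Dec (LinkAdj G m (proj₁ p) (proj₂ p))
    adjacent-pair? (a , b) = adjacent? a b

    edges : List Edge
    edges = collect adjacent-pair? (cartesianProduct (links m) (links m))

    edges-enumerate : ∀ e → Any (e ≈ᴱ_) edges
    edges-enumerate ((a , b) , p) with find (links-complete a) | find (links-complete b)
    ... | a' , a'∈ , a'≡a | b' , b'∈ , b'≡b =
          Any.map (λ {q} → close {q}) (collect-complete adjacent-pair? (∈-cartesianProduct⁺ a'∈ b'∈)
                                          (adjacent-respects {a} {a'} {b} {b'} a≈a' b≈b' p))
      where
      a≈a' = inj₁ (sym a'≡a)
      b≈b' = inj₁ (sym b'≡b)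
      close : ∀ {q : Edge} → proj₁ q ≡ (a' , b') → ((a , b) , p) ≈ᴱ q
      close {(_ , _) , _} refl = a≈a' , b≈b'

    self-embedding-onto : (F : Embedding (LinkGraph m G) (LinkGraph m G)) →
      (∀ x → Σ (Link G m) λ a → SameLink (f F a) x) ×
      (∀ x y → LinkAdj G m x y → Σ (Link G m) λ a → Σ (Link G m) λ b →
                 LinkAdj G m a b × SameLink (f F a) x × SameLink (f F b) y)
    self-embedding-onto F = vertices-onto , edges-onto
      where
      vertices-onto : ∀ x → Σ (Link G m) λ a → SameLink (f F a) x
      vertices-onto = injective⇒onto LinkSetoid (links m) links-enumerate (f F) (resp F) (inj F)
      F-edge : Edge → Edge
      F-edge ((a , b) , p) = (f F a , f F b) , hom F p
      edges-onto : ∀ x y → LinkAdj G m x y → Σ (Link G m) λ a → Σ (Link G m) λ b →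
                   LinkAdj G m a b × SameLink (f F a) x × SameLink (f F b) y
      edges-onto x y p with injective⇒onto EdgeSetoid edges edges-enumerate F-edge
                              (λ (a≈ , b≈) → resp F a≈ , resp F b≈) (λ (a≈ , b≈) → inj F a≈ , inj F b≈)
                              ((x , y) , p)
      ... | ((a , b) , q) , x≈ , y≈ = a , b , q , x≈ , y≈

    -- L_m(G) does not embed into a graph isomorphic to a proper subgraph of L_m(G):
    -- composing would give a self-embedding that is not onto.
    no-proper-reembedding : ∀ {H} → Embedding (LinkGraph m G) H → ¬ IsoProperSubgraph H (LinkGraph m G)
    no-proper-reembedding {H} into (back , proper) = proper (vertices-onto , edges-onto)
      where
      onto = self-embedding-onto (back ∘ᴱ into)
      vertices-onto : ∀ x → Σ (V H) λ a → SameLink (f back a) x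
      vertices-onto x with proj₁ onto x
      ... | a , x≈ = f into a , x≈
      edges-onto : ∀ x y → LinkAdj G m x y → Σ (V H) λ a → Σ (V H) λ b →
                   Adj H a b × SameLink (f back a) x × SameLink (f back b) y
      edges-onto x y p with proj₂ onto x y p
      ... | a , b , q , x≈ , y≈ = f into a , f into b , hom into q , x≈ , y≈

module VertexDeletion {n'} (X : SimpleGraph (suc n')) (u d : Fin (suc n')) (u≢d : u ≢ d) where

  X-u : SimpleGraph n'
  X-u = record { adj = λ i j → adj X (punchIn u i) (punchIn u j)
               ; sym = λ i j → SimpleGraph.sym X (punchIn u i) (punchIn u j)
               ; irrefl = λ i → irrefl X (punchIn u i) }

  deletion-proper : IsoProperSubgraph (toSGraph X-u) (toSGraph X)
  deletion-proper = record { f = punchIn u ; resp = cong (punchIn u) ; inj = punchIn-injective u _ _ ; hom = λ e → e }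
                  , λ (onto , _) → punchInᵢ≢i u _ (proj₂ (onto u))

  -- squash inverts punchIn u away from u; it carries walks and links of X
  -- avoiding u to walks and links of X − u, injectively
  squash : Fin (suc n') → Fin n'
  squash z with u ≟ z
  ... | yes _ = punchOut u≢d
  ... | no u≢z = punchOut u≢z

  punchIn-squash : ∀ {z} → z ≢ u → punchIn u (squash z) ≡ z
  punchIn-squash {z} z≢u with u ≟ z
  ... | yes u≡z = ⊥-elim (z≢u (sym u≡z))
  ... | no u≢z = punchIn-punchOut u≢z

  squash-injective : ∀ {y z} → y ≢ u → z ≢ u → squash y ≡ squash z → y ≡ z
  squash-injective y≢u z≢u eq = trans (sym (punchIn-squash y≢u)) (trans (cong (punchIn u) eq) (punchIn-squash z≢u))

  squash-edge : ∀ {y z} → y ≢ u → z ≢ u → E X y z → E X-u (squash y) (squash z)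
  squash-edge y≢u z≢u = subst₂ (E X) (sym (punchIn-squash y≢u)) (sym (punchIn-squash z≢u))

  squash-walk : ∀ xs → NBWalk X xs → ¬ u ∈ xs → NBWalk X-u (List.map squash xs)
  squash-walk [] _ _ = tt
  squash-walk (x ∷ []) _ _ = tt
  squash-walk (x ∷ y ∷ []) e u∉ = squash-edge (u∉ ∘ here ∘ sym) (u∉ ∘ there ∘ here ∘ sym) e
  squash-walk (x ∷ y ∷ z ∷ xs) (e , x≢z , w) u∉ =
    squash-edge (u∉ ∘ here ∘ sym) (u∉ ∘ there ∘ here ∘ sym) e ,
    x≢z ∘ squash-injective (u∉ ∘ here ∘ sym) (u∉ ∘ there ∘ there ∘ here ∘ sym) ,
    squash-walk (y ∷ z ∷ xs) w (u∉ ∘ there)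

  squash-link : ∀ {m} (P : Link X m) → ¬ u ∈ toList (verts P) → Link X-u m
  squash-link P u∉ = mkLink (Vec.map squash (verts P))
    (subst (NBWalk X-u) (sym (toList-map squash (verts P))) (squash-walk _ (isLink P) u∉))

  squash-vec-injective : ∀ {k} (Y Z : Vec (Fin (suc n')) k) → ¬ u ∈ toList Y → ¬ u ∈ toList Z →
                         Vec.map squash Y ≡ Vec.map squash Z → Y ≡ Z
  squash-vec-injective [] [] _ _ _ = refl
  squash-vec-injective (y ∷ Y) (z ∷ Z) u∉Y u∉Z eq =
    cong₂ _∷_ (squash-injective (u∉Y ∘ here ∘ sym) (u∉Z ∘ here ∘ sym) (cong Vec.head eq))
              (squash-vec-injective Y Z (u∉Y ∘ there) (u∉Z ∘ there) (cong Vec.tail eq))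

  squash-oriented : ∀ {k} {Y Z : Vec (Fin (suc n')) k} → Oriented Y Z → Oriented (Vec.map squash Y) (Vec.map squash Z)
  squash-oriented (inj₁ refl) = inj₁ refl
  squash-oriented {Z = Z} (inj₂ refl) = inj₂ (map-reverse squash Z)

  module _ (ℓ : ℕ) (avoid : ∀ (P : Link X ℓ) → ¬ u ∈ toList (verts P)) where

    avoid-oriented : ∀ {Y} (a : Link X ℓ) → Oriented Y (verts a) → ¬ u ∈ toList Y
    avoid-oriented a Y≈a = avoid a ∘ any-oriented Y≈a

    link-embedding : Embedding (LinkGraph ℓ X) (LinkGraph ℓ X-u)
    link-embedding = record { f = λ a → squash-link a (avoid a) ; resp = squash-oriented
                            ; inj = λ {a} {b} → unsquash {a} {b} ; hom = λ {a} {b} → squash-adj {a} {b} }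
      where
      unsquash : ∀ {a b : Link X ℓ} → SameLink (squash-link a (avoid a)) (squash-link b (avoid b)) → SameLink a b
      unsquash {a} {b} (inj₁ eq) = inj₁ (squash-vec-injective _ _ (avoid a) (avoid b) eq)
      unsquash {a} {b} (inj₂ eq) = inj₂ (squash-vec-injective _ _ (avoid a) (avoid b ∘ any-oriented (inj₂ refl))
                                            (trans eq (sym (map-reverse squash (verts b)))))
      squash-adj : ∀ {a b : Link X ℓ} → LinkAdj X ℓ a b →
                   LinkAdj X-u ℓ (squash-link a (avoid a)) (squash-link b (avoid b))
      squash-adj {a} {b} (mkLink (x ∷ W) walk , init≈a , tail≈b) =
        squash-link (mkLink (x ∷ W) walk) u∉ ,
        subst (λ Y → Oriented Y (Vec.map squash (verts a))) (sym (init-map squash (x ∷ W))) (squash-oriented init≈a) ,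
        squash-oriented tail≈b
        where
        u∉ : ¬ u ∈ toList (x ∷ W)
        u∉ (here u≡x) = avoid-oriented a init≈a (here u≡x)
        u∉ (there u∈W) = avoid-oriented b tail≈b u∈W

-- In an ℓ-minimal graph X every vertex u (with another vertex d present)
-- lies on an ℓ-link: otherwise L_ℓ(X) embeds into L_ℓ(X − u), which by
-- minimality is isomorphic to a proper subgraph of L_ℓ(X).
vertex-on-link : ∀ {n'} (X : SimpleGraph (suc n')) ℓ →
                 (∀ m (Y : SimpleGraph m) → IsoProperSubgraph (toSGraph Y) (toSGraph X) →
                    IsoProperSubgraph (LinkGraph ℓ Y) (LinkGraph ℓ X)) →
                 ∀ u d → u ≢ d → Σ (Link X ℓ) λ P → u ∈ toList (verts P)
vertex-on-link {n'} X ℓ minimal u d u≢d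
  with any? (λ P → DecMembership._∈?_ _≟_ u (toList (verts P))) (FiniteLinks.links X ℓ)
... | yes found = satisfied found
... | no none = ⊥-elim (FiniteLinks.no-proper-reembedding X ℓ (link-embedding ℓ avoid)
                         (minimal n' X-u deletion-proper))
  where
  open VertexDeletion X u d u≢d
  avoid : ∀ (P : Link X ℓ) → ¬ u ∈ toList (verts P)
  avoid P u∈P = none (Any.map (λ eq → subst (λ Y → u ∈ toList Y) (sym eq) u∈P) (FiniteLinks.links-complete X P))

module Theorem {n'} (T : SimpleGraph (suc n')) (conn : Connected T) (acyclic : Acyclic T)
               (v : Fin (suc n')) (ℓ : ℕ) (ecc : EccLess T v ℓ)
               (minimal : ∀ m (Y : SimpleGraph m) → IsoProperSubgraph (toSGraph Y) (toSGraph T) →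
                            IsoProperSubgraph (LinkGraph ℓ Y) (LinkGraph ℓ T)) where

  open Rooted T conn v
  open RootedLinks T conn acyclic v ℓ ecc

  deepest : Fin (suc n')
  deepest = argmax depth v (allFin (suc n'))

  deepest-max : ∀ y → depth y ≤ depth deepest
  deepest-max y = All.lookup (f[xs]≤f[argmax] {f = depth} v (allFin (suc n'))) (∈-allFin y)

  x : Fin (suc n')
  x = branch deepest

  private-link : ∀ {w} → E T v w → w ≢ x →
                 Σ (Link T ℓ) λ R → Meets w R × (∀ c → Meets c R → c ≡ w ⊎ c ≡ x)
  private-link {w} e w≢x = by-shape (link-shape P w∈P w≢v)
    where
    w≢v = E-distinct T e ∘ sym
    on-link = vertex-on-link T ℓ minimal w v w≢v
    P = proj₁ on-link
    w∈P = proj₂ on-link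
    branch-w : branch w ≡ w
    branch-w = branch-neighbour e
    by-shape : (∀ c → Meets c P → c ≡ branch w) ⊎ Arms w →
               Σ (Link T ℓ) λ R → Meets w R × (∀ c → Meets c R → c ≡ w ⊎ c ≡ x)
    -- a link avoiding v is private already
    by-shape (inj₁ one-branch) = P , meets-w , λ c meets → inj₁ (trans (one-branch c meets) branch-w)
      where meets-w = Any.map (λ { refl → w≢v , branch-w }) w∈P
    -- otherwise bend its w-arm towards the deepest vertex
    by-shape (inj₂ (u , o , u≢v , o≢v , u-branch , depths)) = Q , subst (λ c → Meets c Q) bu≡w meets-u , only-w-x
      where
      bu≡w : branch u ≡ w
      bu≡w = trans u-branch branch-w
      bent = bend-link (depth o) u≢v (depth-nonroot o≢v) depths (deepest-max o)
                       (λ eq → w≢x (trans (sym bu≡w) eq))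
      Q = proj₁ bent
      meets-u = proj₁ (proj₂ bent)
      relabel : ∀ {c} → c ≡ branch u ⊎ c ≡ x → c ≡ w ⊎ c ≡ x
      relabel (inj₁ c≡bu) = inj₁ (trans c≡bu bu≡w)
      relabel (inj₂ c≡x) = inj₂ c≡x
      only-w-x : ∀ c → Meets c Q → c ≡ w ⊎ c ≡ x
      only-w-x c meets = relabel (proj₂ (proj₂ bent) c meets)

  -- Private links of distinct neighbours lie in distinct components, since
  -- the branches a link meets are constant on its component.
  degree-bound : ∀ k → HasComponents (LinkGraph ℓ T) k → degree T v ≤ k + 1
  degree-bound k (component , _ , same-component) = countTrue-except (adj T v) x Φ Φ-injective
    where
    Φ : ∀ w → adj T v w ≡ true → w ≢ x → Fin k
    Φ w e w≢x = component (proj₁ (private-link e w≢x))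
    Φ-injective : ∀ w w′ e e′ w≢x w′≢x → Φ w e w≢x ≡ Φ w′ e′ w′≢x → w ≡ w′
    Φ-injective w w′ e e′ w≢x w′≢x same = not-x (only-w′-x w meets-w)
      where
      R = proj₁ (private-link e w≢x)
      R′ = proj₁ (private-link e′ w′≢x)
      only-w′-x = proj₂ (proj₂ (private-link e′ w′≢x))
      -- R and R′ lie in one component, so R′ meets branch w as R does
      meets-w : Meets w R′
      meets-w = meets-connected (Equivalence.to (same-component R R′) same) (proj₁ (proj₂ (private-link e w≢x)))
      not-x : w ≡ w′ ⊎ w ≡ x → w ≡ w′
      not-x (inj₁ w≡w′) = w≡w′
      not-x (inj₂ w≡x) = ⊥-elim (w≢x w≡x)

lemma6p7 : (ℓ : ℕ) → 1 ≤ ℓ → (n : ℕ) (T : SimpleGraph n) → IsTree T →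
    IsMinimal ℓ T → (v : Fin n) → EccLess T v ℓ →
    (k : ℕ) → HasComponents (LinkGraph ℓ T) k → degree T v ≤ k + 1
lemma6p7 ℓ _ zero T _ _ () _ _ _
lemma6p7 ℓ _ (suc n') T _ (inj₁ ()) v _ _ _
lemma6p7 ℓ _ (suc n') T (conn , acyclic) (inj₂ minimal) v ecc k components =
  Theorem.degree-bound T conn acyclic v ℓ ecc minimal k components
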